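{- Let $k,m\ge 1$ and $n\ge 1$ be integers, and for $j\ge 0$ let $C_{k,m}(j)=\frac{1}{mj+1}\binom{(mj+1)k}{j}$. Then $$C_{k,m}(n)=\frac{(mn+1)k+1-n}{(m+1)n}\sum_{\substack{i_1,\dots,i_{m+1}\ge 0\\ i_1+\cdots+i_{m+1}=n-1}}C_{k,m}(i_1)C_{k,m}(i_2)\cdots C_{k,m}(i_{m+1}).$$ -}

module Defs where

open import Data.Nat using (ℕ; zero; suc; _+_; _*_; _∸_)
open import Data.Nat.Combinatorics using (_C_)
open import Data.Integer using (+_)
open import Data.Rational using (ℚ; _/_; 1ℚ; 0ℚ) renaming (_*_ to _*ℚ_; _+_ to _+ℚ_)
open import Data.List using (List; []; _∷_; map; concatMap; upTo; foldr)
open import Data.Vec using (Vec; []; _∷_)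

Ckm : ℕ → ℕ → ℕ → ℚ
Ckm k m j = (+ ((suc (m * j) * k) C j)) / suc (m * j)

compositions : (p : ℕ) → ℕ → List (Vec ℕ p)
compositions zero    zero    = [] ∷ []
compositions zero    (suc _) = []
compositions (suc p) s       =
  concatMap (λ i → map (i ∷_) (compositions p (s ∸ i))) (upTo (suc s))

prodVec : ∀ {p} → (ℕ → ℚ) → Vec ℕ p → ℚ
prodVec f []       = 1ℚ
prodVec f (i ∷ is) = f i *ℚ prodVec f is

sumℚ : List ℚ → ℚ
sumℚ = foldr _+ℚ_ 0ℚ

convSum : ℕ → ℕ → ℕ → ℚ
convSum k m s = sumℚ (map (prodVec (Ckm k m)) (compositions (suc m) s))

-- C_{k,m}(j) is the Raney number R_x(j) = x/(x + aj) · C(x + aj, j) with step a = mk at x = k.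
-- Defined by R_x(0) = 1, R_0(n+1) = 0, R_{x+1}(n+1) = R_x(n+1) + R_{x+a}(n), these numbers
-- satisfy R_x ⋆ R_y = R_{x+y} for the Cauchy product ⋆, so the sum over compositions of n − 1
-- into m + 1 parts is R_{(m+1)k}(n − 1); their closed form follows from the recursion using
-- (j+1)·C(N, j+1) + j·C(N, j) = N·C(N, j). With N = (mn+1)k both sides of the theorem reduce to
-- C(N, n) and C(N, n − 1), which are related by n·C(N, n) = (N + 1 − n)·C(N, n − 1).

module Submission where

open import Defs
open import Data.Nat using (ℕ; zero; suc; _+_; _*_; _∸_; _≤_; s≤s; NonZero; >-nonZero; >-nonZero⁻¹)
open import Data.Nat.Properties
open import Data.Nat.Combinatorics using (_C_; nC1≡n; nCk+nC[k+1]≡[n+1]C[k+1])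
open import Data.Nat.ListAction using (sum)
open import Data.Nat.ListAction.Properties using (sum-++)
open import Data.Nat.Tactic.RingSolver using (solve-∀)
open import Data.Integer using (+_; _⊖_) renaming (_-_ to _-ℤ_; _+_ to _+ℤ_)
import Data.Integer.Properties as ℤ
open import Data.Rational using (ℚ; _/_; toℚᵘ; fromℚᵘ) renaming (_*_ to _*ℚ_; _+_ to _+ℚ_)
open import Data.Rational.Properties using (toℚᵘ-fromℚᵘ; fromℚᵘ-cong; fromℚᵘ-toℚᵘ; /-cong)
open import Data.Rational.Properties using (toℚᵘ-homo-*; toℚᵘ-homo-+)
open import Data.Rational.Unnormalised as ℚᵘ using (mkℚᵘ; *≡*)
import Data.Rational.Unnormalised.Properties as ℚᵘ
open import Data.List using (List; []; _∷_; _++_; map; concatMap; upTo; applyUpTo)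
open import Data.List.Properties using (map-++; map-∘; map-cong; map-applyUpTo)
open import Data.Vec using (Vec; []; _∷_)
open import Function using (_∘_)
open import Relation.Binary.PropositionalEquality
open ≡-Reasoning
open import Algebra.Properties.CommutativeSemigroup +-commutativeSemigroup
  renaming (interchange to +-interchange; xy∙z≈xz∙y to +-rearrange)

[k+1]*[n+1]C[k+1]≡[n+1]*nCk : ∀ n k → suc k * (suc n C suc k) ≡ suc n * (n C k)
[k+1]*[n+1]C[k+1]≡[n+1]*nCk zero    zero    = refl
[k+1]*[n+1]C[k+1]≡[n+1]*nCk zero    (suc k) = *-zeroʳ (suc (suc k))
[k+1]*[n+1]C[k+1]≡[n+1]*nCk (suc n) zero    = begin
  1 * (suc (suc n) C 1) ≡⟨ *-identityˡ _ ⟩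
  suc (suc n) C 1       ≡⟨ nC1≡n (suc (suc n)) ⟩
  suc (suc n)           ≡⟨ *-identityʳ (suc (suc n)) ⟨
  suc (suc n) * 1       ∎
[k+1]*[n+1]C[k+1]≡[n+1]*nCk (suc n) (suc k) = begin
  suc (suc k) * (suc (suc n) C suc (suc k))
    ≡⟨ cong (suc (suc k) *_) (nCk+nC[k+1]≡[n+1]C[k+1] (suc n) (suc k)) ⟨
  suc (suc k) * (B₁ + B₂)
    ≡⟨ distrib k B₁ B₂ ⟩
  suc k * B₁ + B₁ + suc (suc k) * B₂
    ≡⟨ cong₂ (λ u v → u + B₁ + v) ([k+1]*[n+1]C[k+1]≡[n+1]*nCk n k)
                                  ([k+1]*[n+1]C[k+1]≡[n+1]*nCk n (suc k)) ⟩
  suc n * (n C k) + B₁ + suc n * (n C suc k)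
    ≡⟨ regroup n B₁ (n C k) (n C suc k) ⟩
  suc n * (n C k + n C suc k) + B₁
    ≡⟨ cong (λ u → suc n * u + B₁) (nCk+nC[k+1]≡[n+1]C[k+1] n k) ⟩
  suc n * B₁ + B₁
    ≡⟨ +-comm (suc n * B₁) B₁ ⟩
  suc (suc n) * B₁ ∎
  where
  B₁ B₂ : ℕ
  B₁ = suc n C suc k
  B₂ = suc n C suc (suc k)
  distrib : ∀ k A B → suc (suc k) * (A + B) ≡ suc k * A + A + suc (suc k) * B
  distrib = solve-∀
  regroup : ∀ n A X Y → suc n * X + A + suc n * Y ≡ suc n * (X + Y) + A
  regroup = solve-∀

[k+1]*nC[k+1]+k*nCk≡n*nCk : ∀ n k → suc k * (n C suc k) + k * (n C k) ≡ n * (n C k)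
[k+1]*nC[k+1]+k*nCk≡n*nCk zero    zero    = refl
[k+1]*nC[k+1]+k*nCk≡n*nCk zero    (suc k) = cong₂ _+_ (*-zeroʳ (suc (suc k))) (*-zeroʳ (suc k))
[k+1]*nC[k+1]+k*nCk≡n*nCk (suc n) zero    = begin
  1 * (suc n C 1) + 0 ≡⟨ +-identityʳ _ ⟩
  1 * (suc n C 1)     ≡⟨ [k+1]*[n+1]C[k+1]≡[n+1]*nCk n 0 ⟩
  suc n * 1           ∎
[k+1]*nC[k+1]+k*nCk≡n*nCk (suc n) (suc k) = begin
  suc (suc k) * (suc n C suc (suc k)) + suc k * (suc n C suc k)
    ≡⟨ cong₂ _+_ ([k+1]*[n+1]C[k+1]≡[n+1]*nCk n (suc k)) ([k+1]*[n+1]C[k+1]≡[n+1]*nCk n k) ⟩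
  suc n * (n C suc k) + suc n * (n C k)
    ≡⟨ *-distribˡ-+ (suc n) (n C suc k) (n C k) ⟨
  suc n * (n C suc k + n C k)
    ≡⟨ cong (suc n *_) (trans (+-comm (n C suc k) (n C k)) (nCk+nC[k+1]≡[n+1]C[k+1] n k)) ⟩
  suc n * (suc n C suc k) ∎

[k+1]*nC[k+1]≡[n∸k]*nCk : ∀ {n k} → k ≤ n → suc k * (n C suc k) ≡ (n ∸ k) * (n C k)
[k+1]*nC[k+1]≡[n∸k]*nCk {n} {k} k≤n = +-cancelʳ-≡ (k * (n C k)) _ _ (begin
  suc k * (n C suc k) + k * (n C k) ≡⟨ [k+1]*nC[k+1]+k*nCk≡n*nCk n k ⟩
  n * (n C k)                       ≡⟨ cong (_* (n C k)) (m∸n+n≡m k≤n) ⟨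
  (n ∸ k + k) * (n C k)             ≡⟨ *-distribʳ-+ (n C k) (n ∸ k) k ⟩
  (n ∸ k) * (n C k) + k * (n C k)   ∎)

infixl 7 _⋆_

_⋆_ : (ℕ → ℕ) → (ℕ → ℕ) → ℕ → ℕ
(f ⋆ g) s = sum (applyUpTo (λ i → f i * g (s ∸ i)) (suc s))

⋆-zeroˡ : ∀ g s → ((λ _ → 0) ⋆ g) s ≡ 0
⋆-zeroˡ g zero    = refl
⋆-zeroˡ g (suc s) = ⋆-zeroˡ g s

⋆-congʳ : ∀ f {g h} → (∀ t → g t ≡ h t) → ∀ s → (f ⋆ g) s ≡ (f ⋆ h) s
⋆-congʳ f g≗h zero    = cong (λ u → f 0 * u + 0) (g≗h 0)
⋆-congʳ f g≗h (suc s) = cong₂ _+_ (cong (f 0 *_) (g≗h (suc s))) (⋆-congʳ (f ∘ suc) g≗h s)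

⋆-distribʳ-+ : ∀ f g h s → ((λ i → f i + g i) ⋆ h) s ≡ (f ⋆ h) s + (g ⋆ h) s
⋆-distribʳ-+ f g h zero    =
  trans (cong (_+ 0) (*-distribʳ-+ (h 0) (f 0) (g 0))) (+-interchange (f 0 * h 0) (g 0 * h 0) 0 0)
⋆-distribʳ-+ f g h (suc s) =
  trans (cong₂ _+_ (*-distribʳ-+ (h (suc s)) (f 0) (g 0)) (⋆-distribʳ-+ (f ∘ suc) (g ∘ suc) h s))
        (+-interchange (f 0 * h (suc s)) (g 0 * h (suc s)) _ _)

raney : ℕ → ℕ → ℕ → ℕ
raney a x       zero    = 1
raney a zero    (suc n) = 0
raney a (suc x) (suc n) = raney a x (suc n) + raney a (x + a) n

raney-⋆ : ∀ a x y n → (raney a x ⋆ raney a y) n ≡ raney a (x + y) n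
raney-⋆ a x       y zero    = refl
raney-⋆ a zero    y (suc n) =
  trans (cong₂ _+_ (*-identityˡ _) (⋆-zeroˡ (raney a y) n)) (+-identityʳ _)
raney-⋆ a (suc x) y (suc n) = begin
  (raney a (suc x) ⋆ raney a y) (suc n)
    ≡⟨ cong (_+_ (1 * raney a y (suc n)))
            (⋆-distribʳ-+ (raney a x ∘ suc) (raney a (x + a)) (raney a y) n) ⟩
  1 * raney a y (suc n) + ((raney a x ∘ suc ⋆ raney a y) n + (raney a (x + a) ⋆ raney a y) n)
    ≡⟨ +-assoc (1 * raney a y (suc n)) _ _ ⟨
  (raney a x ⋆ raney a y) (suc n) + (raney a (x + a) ⋆ raney a y) n
    ≡⟨ cong₂ _+_ (raney-⋆ a x y (suc n)) (raney-⋆ a (x + a) y n) ⟩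
  raney a (x + y) (suc n) + raney a (x + a + y) n
    ≡⟨ cong (λ z → raney a (x + y) (suc n) + raney a z n) (+-rearrange x a y) ⟩
  raney a (x + y) (suc n) + raney a (x + y + a) n ∎

raney-closed : ∀ a .{{_ : NonZero a}} x n → (x + a * n) * raney a x n ≡ x * ((x + a * n) C n)
raney-closed a x       zero    = cong (_* 1) (trans (cong (_+_ x) (*-zeroʳ a)) (+-identityʳ x))
raney-closed a zero    (suc n) = *-zeroʳ (a * suc n)
raney-closed a (suc x) (suc n) = *-cancelˡ-≡ _ _ N (begin
  N * (suc N * (T₁ + T₂))
    ≡⟨ distribute N T₁ T₂ ⟩
  suc N * (N * T₁) + suc N * (N * T₂)
    ≡⟨ cong₂ (λ u v → suc N * u + suc N * v) (raney-closed a x (suc n)) shifted ⟩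
  suc N * (x * B₁) + suc N * ((x + a) * B₀)
    ≡⟨ +-cancelʳ-≡ (a * (N * B₀)) _ _ (trans
         (cong (λ u → suc N * (x * B₁) + suc N * ((x + a) * B₀) + a * u)
               (sym ([k+1]*nC[k+1]+k*nCk≡n*nCk N n)))
         (balanced x a n B₀ B₁)) ⟩
  N * (suc x * (B₀ + B₁))
    ≡⟨ cong (λ u → N * (suc x * u)) (nCk+nC[k+1]≡[n+1]C[k+1] N n) ⟩
  N * (suc x * (suc N C suc n)) ∎)
  where
  N T₁ T₂ B₀ B₁ : ℕ
  N  = x + a * suc n
  T₁ = raney a x (suc n)
  T₂ = raney a (x + a) n
  B₀ = N C n
  B₁ = N C suc n
  instance
    N≢0 : NonZero N
    N≢0 = >-nonZero (<-≤-trans (>-nonZero⁻¹ (a * suc n) {{m*n≢0 a (suc n)}}) (m≤n+m (a * suc n) x))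
  shifted : N * T₂ ≡ (x + a) * B₀
  shifted = subst (λ M → M * T₂ ≡ (x + a) * (M C n))
                  (trans (+-assoc x a (a * n)) (cong (_+_ x) (sym (*-suc a n))))
                  (raney-closed a (x + a) n)
  distribute : ∀ N T₁ T₂ → N * (suc N * (T₁ + T₂)) ≡ suc N * (N * T₁) + suc N * (N * T₂)
  distribute = solve-∀
  -- a · (N · B₀) is added to both sides so that no subtraction occurs; it is then a semiring identity.
  balanced : ∀ x a n B₀ B₁ →
    suc (x + a * suc n) * (x * B₁) + suc (x + a * suc n) * ((x + a) * B₀) + a * (suc n * B₁ + n * B₀)
      ≡ (x + a * suc n) * (suc x * (B₀ + B₁)) + a * ((x + a * suc n) * B₀)
  balanced = solve-∀

raney-closed-at : ∀ a .{{_ : NonZero a}} x n {N} → x + a * n ≡ N → N * raney a x n ≡ x * (N C n)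
raney-closed-at a x n refl = raney-closed a x n

sum-map-concatMap : ∀ {A B : Set} (f : B → ℕ) (g : A → List B) xs →
                    sum (map f (concatMap g xs)) ≡ sum (map (λ x → sum (map f (g x))) xs)
sum-map-concatMap f g []       = refl
sum-map-concatMap f g (x ∷ xs) = begin
  sum (map f (g x ++ concatMap g xs))
    ≡⟨ cong sum (map-++ f (g x) (concatMap g xs)) ⟩
  sum (map f (g x) ++ map f (concatMap g xs))
    ≡⟨ sum-++ (map f (g x)) (map f (concatMap g xs)) ⟩
  sum (map f (g x)) + sum (map f (concatMap g xs))
    ≡⟨ cong (_+_ (sum (map f (g x)))) (sum-map-concatMap f g xs) ⟩
  sum (map f (g x)) + sum (map (λ x → sum (map f (g x))) xs) ∎

sum-map-*ˡ : ∀ {A : Set} c (f : A → ℕ) xs → sum (map (λ x → c * f x) xs) ≡ c * sum (map f xs)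
sum-map-*ˡ c f []       = sym (*-zeroʳ c)
sum-map-*ˡ c f (x ∷ xs) =
  trans (cong (_+_ (c * f x)) (sum-map-*ˡ c f xs)) (sym (*-distribˡ-+ c (f x) _))

prodVecℕ : ∀ {p} → (ℕ → ℕ) → Vec ℕ p → ℕ
prodVecℕ f []       = 1
prodVecℕ f (i ∷ is) = f i * prodVecℕ f is

compositionSum : (ℕ → ℕ) → ℕ → ℕ → ℕ
compositionSum f p s = sum (map (prodVecℕ f) (compositions p s))

compositionSum-suc : ∀ f p s → compositionSum f (suc p) s ≡ (f ⋆ compositionSum f p) s
compositionSum-suc f p s = begin
  sum (map P (concatMap (λ i → map (i ∷_) (L i)) (upTo (suc s))))
    ≡⟨ sum-map-concatMap P (λ i → map (i ∷_) (L i)) (upTo (suc s)) ⟩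
  sum (map (λ i → sum (map P (map (i ∷_) (L i)))) (upTo (suc s)))
    ≡⟨ cong sum (map-cong head-factor (upTo (suc s))) ⟩
  sum (map (λ i → f i * compositionSum f p (s ∸ i)) (upTo (suc s)))
    ≡⟨ cong sum (map-applyUpTo (λ i → i) _ (suc s)) ⟩
  (f ⋆ compositionSum f p) s ∎
  where
  P : ∀ {q} → Vec ℕ q → ℕ
  P = prodVecℕ f
  L : ℕ → List (Vec ℕ p)
  L i = compositions p (s ∸ i)
  head-factor : ∀ i → sum (map P (map (i ∷_) (L i))) ≡ f i * compositionSum f p (s ∸ i)
  head-factor i = trans (cong sum (sym (map-∘ (L i)))) (sum-map-*ˡ (f i) P (L i))

raney-compositionSum : ∀ a r p s → compositionSum (raney a r) p s ≡ raney a (p * r) s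
raney-compositionSum a r zero    zero    = refl
raney-compositionSum a r zero    (suc s) = refl
raney-compositionSum a r (suc p) s       = begin
  compositionSum (raney a r) (suc p) s
    ≡⟨ compositionSum-suc (raney a r) p s ⟩
  (raney a r ⋆ compositionSum (raney a r) p) s
    ≡⟨ ⋆-congʳ (raney a r) (raney-compositionSum a r p) s ⟩
  (raney a r ⋆ raney a (p * r)) s
    ≡⟨ raney-⋆ a r (p * r) s ⟩
  raney a (r + p * r) s ∎

fromℚᵘ-homo-* : ∀ p q → fromℚᵘ (p ℚᵘ.* q) ≡ fromℚᵘ p *ℚ fromℚᵘ q
fromℚᵘ-homo-* p q = begin
  fromℚᵘ (p ℚᵘ.* q)
    ≡⟨ fromℚᵘ-cong (ℚᵘ.*-cong (ℚᵘ.≃-sym (toℚᵘ-fromℚᵘ p))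
                              (ℚᵘ.≃-sym (toℚᵘ-fromℚᵘ q))) ⟩
  fromℚᵘ (toℚᵘ (fromℚᵘ p) ℚᵘ.* toℚᵘ (fromℚᵘ q))
    ≡⟨ fromℚᵘ-cong (toℚᵘ-homo-* (fromℚᵘ p) (fromℚᵘ q)) ⟨
  fromℚᵘ (toℚᵘ (fromℚᵘ p *ℚ fromℚᵘ q))
    ≡⟨ fromℚᵘ-toℚᵘ (fromℚᵘ p *ℚ fromℚᵘ q) ⟩
  fromℚᵘ p *ℚ fromℚᵘ q ∎

fromℚᵘ-homo-+ : ∀ p q → fromℚᵘ (p ℚᵘ.+ q) ≡ fromℚᵘ p +ℚ fromℚᵘ q
fromℚᵘ-homo-+ p q = begin
  fromℚᵘ (p ℚᵘ.+ q)
    ≡⟨ fromℚᵘ-cong (ℚᵘ.+-cong (ℚᵘ.≃-sym (toℚᵘ-fromℚᵘ p))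
                              (ℚᵘ.≃-sym (toℚᵘ-fromℚᵘ q))) ⟩
  fromℚᵘ (toℚᵘ (fromℚᵘ p) ℚᵘ.+ toℚᵘ (fromℚᵘ q))
    ≡⟨ fromℚᵘ-cong (toℚᵘ-homo-+ (fromℚᵘ p) (fromℚᵘ q)) ⟨
  fromℚᵘ (toℚᵘ (fromℚᵘ p +ℚ fromℚᵘ q))
    ≡⟨ fromℚᵘ-toℚᵘ (fromℚᵘ p +ℚ fromℚᵘ q) ⟩
  fromℚᵘ p +ℚ fromℚᵘ q ∎

/-cross : ∀ a b {d e} → a * suc e ≡ b * suc d → + a / suc d ≡ + b / suc e
/-cross a b {d} {e} eq =
  fromℚᵘ-cong {mkℚᵘ (+ a) d} {mkℚᵘ (+ b) e}
    (*≡* (trans (sym (ℤ.pos-* a (suc e))) (trans (cong +_ eq) (ℤ.pos-* b (suc d)))))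

fromℕ : ℕ → ℚ
fromℕ n = + n / 1

/-*-fromℕ : ∀ a d b → (+ a / suc d) *ℚ fromℕ b ≡ + (a * b) / suc d
/-*-fromℕ a d b = trans (sym (fromℚᵘ-homo-* (mkℚᵘ (+ a) d) (mkℚᵘ (+ b) 0)))
                        (/-cong (sym (ℤ.pos-* a b)) (*-identityʳ (suc d)))

fromℕ-homo-* : ∀ a b → fromℕ (a * b) ≡ fromℕ a *ℚ fromℕ b
fromℕ-homo-* a b = sym (/-*-fromℕ a 0 b)

fromℕ-homo-+ : ∀ a b → fromℕ (a + b) ≡ fromℕ a +ℚ fromℕ b
fromℕ-homo-+ a b =
  trans (/-cong (cong₂ _+ℤ_ (sym (ℤ.*-identityʳ (+ a))) (sym (ℤ.*-identityʳ (+ b)))) refl)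
        (fromℚᵘ-homo-+ (mkℚᵘ (+ a) 0) (mkℚᵘ (+ b) 0))

prodVec-fromℕ : ∀ {p f g} → (∀ i → f i ≡ fromℕ (g i)) →
                (v : Vec ℕ p) → prodVec f v ≡ fromℕ (prodVecℕ g v)
prodVec-fromℕ f≗g []      = refl
prodVec-fromℕ {g = g} f≗g (i ∷ v) =
  trans (cong₂ _*ℚ_ (f≗g i) (prodVec-fromℕ f≗g v)) (sym (fromℕ-homo-* (g i) (prodVecℕ g v)))

sumℚ-map-fromℕ : ∀ {A : Set} {f : A → ℚ} {g : A → ℕ} → (∀ x → f x ≡ fromℕ (g x)) →
                 ∀ xs → sumℚ (map f xs) ≡ fromℕ (sum (map g xs))
sumℚ-map-fromℕ f≗g []       = refl
sumℚ-map-fromℕ {g = g} f≗g (x ∷ xs) =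
  trans (cong₂ _+ℚ_ (f≗g x) (sumℚ-map-fromℕ f≗g xs)) (sym (fromℕ-homo-+ (g x) (sum (map g xs))))

Ckm≡raney : ∀ k m .{{_ : NonZero k}} .{{_ : NonZero m}} j → Ckm k m j ≡ fromℕ (raney (m * k) k j)
Ckm≡raney k m j = /-cross B R (*-cancelˡ-≡ _ _ k (begin
  k * (B * 1)              ≡⟨ cong (k *_) (*-identityʳ B) ⟩
  k * B                    ≡⟨ raney-closed-at (m * k) k j (factor m k j) ⟨
  suc (m * j) * k * R      ≡⟨ regroup (suc (m * j)) k R ⟩
  k * (R * suc (m * j))    ∎))
  where
  B R : ℕ
  B = (suc (m * j) * k) C j
  R = raney (m * k) k j
  instance
    mk≢0 : NonZero (m * k)
    mk≢0 = m*n≢0 m k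
  factor : ∀ m k j → k + m * k * j ≡ suc (m * j) * k
  factor = solve-∀
  regroup : ∀ s k R → s * k * R ≡ k * (R * s)
  regroup = solve-∀

convSum≡raney : ∀ k m .{{_ : NonZero k}} .{{_ : NonZero m}} s →
                convSum k m s ≡ fromℕ (raney (m * k) (suc m * k) s)
convSum≡raney k m s =
  trans (sumℚ-map-fromℕ (prodVec-fromℕ (Ckm≡raney k m)) (compositions (suc m) s))
        (cong fromℕ (raney-compositionSum (m * k) k (suc m) s))

n≤[m[n+1]+1]k : ∀ k m .{{_ : NonZero k}} .{{_ : NonZero m}} n → n ≤ suc (m * suc n) * k
n≤[m[n+1]+1]k k m n =
  ≤-trans (n≤1+n n) (≤-trans (m≤n*m (suc n) m) (≤-trans (n≤1+n _) (m≤m*n (suc (m * suc n)) k)))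

Ckm-recurrence-ℕ : ∀ k m .{{_ : NonZero k}} .{{_ : NonZero m}} n → let N = suc (m * suc n) * k in
  (N C suc n) * (suc m * suc n) ≡ (N ∸ n) * raney (m * k) (suc m * k) n * suc (m * suc n)
Ckm-recurrence-ℕ k m n = *-cancelˡ-≡ _ _ N (begin
  N * (B * (suc m * suc n))
    ≡⟨ regroup₁ N B m (suc n) ⟩
  suc m * N * (suc n * B)
    ≡⟨ cong (suc m * N *_) ([k+1]*nC[k+1]≡[n∸k]*nCk (n≤[m[n+1]+1]k k m n)) ⟩
  suc m * N * ((N ∸ n) * B′)
    ≡⟨ regroup₂ (N ∸ n) s m k B′ ⟩
  (N ∸ n) * s * (suc m * k * B′)
    ≡⟨ cong ((N ∸ n) * s *_) (raney-closed-at (m * k) (suc m * k) n (factor m k n)) ⟨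
  (N ∸ n) * s * (N * c)
    ≡⟨ regroup₃ (N ∸ n) s N c ⟩
  N * ((N ∸ n) * c * s) ∎)
  where
  s N B B′ c : ℕ
  s  = suc (m * suc n)
  N  = s * k
  B  = N C suc n
  B′ = N C n
  c  = raney (m * k) (suc m * k) n
  instance
    mk≢0 : NonZero (m * k)
    mk≢0 = m*n≢0 m k
    N≢0 : NonZero N
    N≢0 = m*n≢0 s k
  factor : ∀ m k n → suc m * k + m * k * n ≡ suc (m * suc n) * k
  factor = solve-∀
  regroup₁ : ∀ N B m n → N * (B * (suc m * n)) ≡ suc m * N * (n * B)
  regroup₁ = solve-∀
  regroup₂ : ∀ M s m k C → suc m * (s * k) * (M * C) ≡ M * s * (suc m * k * C)
  regroup₂ = solve-∀
  regroup₃ : ∀ M s N c → M * s * (N * c) ≡ N * (M * c * s)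
  regroup₃ = solve-∀

+[m+1]-+[n+1]≡+[m∸n] : ∀ {m n} → n ≤ m → + (m + 1) -ℤ + suc n ≡ + (m ∸ n)
+[m+1]-+[n+1]≡+[m∸n] {m} {n} n≤m =
  trans (ℤ.m-n≡m⊖n (m + 1) (suc n)) (trans (cong (_⊖ suc n) (+-comm m 1)) (ℤ.⊖-≥ (s≤s n≤m)))

lemma3p3 : (k m n : ℕ) → 1 ≤ k → 1 ≤ m → (n≥1 : 1 ≤ n) →
    Ckm k m n ≡
      ((((+ ((suc (m * n) * k) + 1)) -ℤ (+ n)) / (suc m * n)) {{m*n≢0 (suc m) n {{_}} {{>-nonZero n≥1}}}})
        *ℚ convSum k m (n ∸ 1)
lemma3p3 k m (suc n) 1≤k 1≤m _ = begin
  Ckm k m (suc n)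
    ≡⟨ /-cross (N C suc n) ((N ∸ n) * c) (Ckm-recurrence-ℕ k m n) ⟩
  + ((N ∸ n) * c) / (suc m * suc n)
    ≡⟨ /-*-fromℕ (N ∸ n) _ c ⟨
  (+ (N ∸ n) / (suc m * suc n)) *ℚ fromℕ c
    ≡⟨ cong₂ _*ℚ_ (/-cong (sym (+[m+1]-+[n+1]≡+[m∸n] (n≤[m[n+1]+1]k k m n))) refl)
                  (sym (convSum≡raney k m n)) ⟩
  ((+ (N + 1) -ℤ + suc n) / (suc m * suc n)) *ℚ convSum k m n ∎
  where
  N c : ℕ
  N = suc (m * suc n) * k
  c = raney (m * k) (suc m * k) n
  instance
    k≢0 : NonZero k
    k≢0 = >-nonZero 1≤k
    m≢0 : NonZero m
    m≢0 = >-nonZero 1≤m
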